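{- Let $\delta,K_1,K_2,C_0,C_1$ be admissible parameters. Then there exists a magic parameter $M$.
   Context: Parameters $\delta,K_1,K_2,C_0,C_1$ are positive integers; acceptable if $3\le\delta<\infty$, $1\le K_1\le K_2\le\delta$, $2\delta+2\le C_0,C_1\le 3\delta+2$, $C_0$ even, $C_1$ odd. $C=\min(C_0,C_1)$, $C'=\max(C_0,C_1)$. Admissible: acceptable and either (II) $C\le 2\delta+K_1$, $C=2K_1+2K_2+1$, $K_1+K_2\ge\delta$, $K_1+2K_2\le 2\delta-1$, and either (IIA) $C'=C+1$ or (IIB) $C'>C+1$, $K_1=K_2$, $3K_2=2\delta-1$; or (III) $C\ge 2\delta+K_1+1$, $K_1+2K_2\ge 2\delta-1$, $3K_2\ge 2\delta$, if $K_1+2K_2=2\delta-1$ then $C\ge 2\delta+K_1+2$, and if $C'>C+1$ then $C\ge 2\delta+K_2$. A distance $M\in\{1,\dots,\delta\}$ is magic if $\max(K_1,\lceil\delta/2\rceil)\le M\le\min(K_2,\lfloor(C-\delta-1)/2\rfloor)$. A magic parameter is a magic distance $M$ such that additionally: (i) if Case (III) holds and $K_1+2K_2=2\delta-1$ then $M>K_1$; (ii) if Case (III) holds, $C'>C+1$ and $C=2\delta+K_2$, then $M<K_2$. -}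

module Defs where

open import Data.Nat using (ℕ; suc; _+_; _*_; _∸_; _≤_; _<_; _≥_; _>_; ⌊_/2⌋; ⌈_/2⌉; _⊔_; _⊓_)
open import Data.Product using (_×_; ∃)
open import Data.Sum using (_⊎_)
open import Relation.Binary.PropositionalEquality using (_≡_)

Even : ℕ → Set
Even n = ∃ λ k → n ≡ 2 * k

Odd : ℕ → Set
Odd n = ∃ λ k → n ≡ suc (2 * k)

-- δ < ∞ is automatic since δ : ℕ.
Acceptable : (δ K₁ K₂ C₀ C₁ : ℕ) → Set
Acceptable δ K₁ K₂ C₀ C₁ =
  3 ≤ δ × 1 ≤ K₁ × K₁ ≤ K₂ × K₂ ≤ δ ×
  2 * δ + 2 ≤ C₀ × C₀ ≤ 3 * δ + 2 ×
  2 * δ + 2 ≤ C₁ × C₁ ≤ 3 * δ + 2 ×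
  Even C₀ × Odd C₁

Cmin : (C₀ C₁ : ℕ) → ℕ
Cmin C₀ C₁ = C₀ ⊓ C₁

Cmax : (C₀ C₁ : ℕ) → ℕ
Cmax C₀ C₁ = C₀ ⊔ C₁

CaseIIA : (δ K₁ K₂ C₀ C₁ : ℕ) → Set
CaseIIA δ K₁ K₂ C₀ C₁ = Cmax C₀ C₁ ≡ Cmin C₀ C₁ + 1

CaseIIB : (δ K₁ K₂ C₀ C₁ : ℕ) → Set
CaseIIB δ K₁ K₂ C₀ C₁ =
  Cmax C₀ C₁ > Cmin C₀ C₁ + 1 × K₁ ≡ K₂ × 3 * K₂ + 1 ≡ 2 * δ

-- 3K₂ = 2δ - 1 written as 3K₂ + 1 = 2δ (δ ≥ 3 so no truncation issue).
CaseII : (δ K₁ K₂ C₀ C₁ : ℕ) → Set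
CaseII δ K₁ K₂ C₀ C₁ =
  let C = Cmin C₀ C₁ in
  C ≤ 2 * δ + K₁ ×
  C ≡ 2 * K₁ + 2 * K₂ + 1 ×
  K₁ + K₂ ≥ δ ×
  K₁ + 2 * K₂ + 1 ≤ 2 * δ ×
  (CaseIIA δ K₁ K₂ C₀ C₁ ⊎ CaseIIB δ K₁ K₂ C₀ C₁)

-- K₁ + 2K₂ ≥ 2δ - 1 written as K₁ + 2K₂ + 1 ≥ 2δ, and
-- K₁ + 2K₂ = 2δ - 1 written as K₁ + 2K₂ + 1 = 2δ.
CaseIII : (δ K₁ K₂ C₀ C₁ : ℕ) → Set
CaseIII δ K₁ K₂ C₀ C₁ =
  let C = Cmin C₀ C₁ ; C' = Cmax C₀ C₁ in
  C ≥ 2 * δ + K₁ + 1 ×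
  K₁ + 2 * K₂ + 1 ≥ 2 * δ ×
  3 * K₂ ≥ 2 * δ ×
  (K₁ + 2 * K₂ + 1 ≡ 2 * δ → C ≥ 2 * δ + K₁ + 2) ×
  (C' > C + 1 → C ≥ 2 * δ + K₂)

Admissible : (δ K₁ K₂ C₀ C₁ : ℕ) → Set
Admissible δ K₁ K₂ C₀ C₁ =
  Acceptable δ K₁ K₂ C₀ C₁ ×
  (CaseII δ K₁ K₂ C₀ C₁ ⊎ CaseIII δ K₁ K₂ C₀ C₁)

MagicDistance : (δ K₁ K₂ C₀ C₁ M : ℕ) → Set
MagicDistance δ K₁ K₂ C₀ C₁ M =
  1 ≤ M × M ≤ δ ×
  K₁ ⊔ ⌈ δ /2⌉ ≤ M ×
  M ≤ K₂ ⊓ ⌊ (Cmin C₀ C₁ ∸ δ ∸ 1) /2⌋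

MagicParameter : (δ K₁ K₂ C₀ C₁ M : ℕ) → Set
MagicParameter δ K₁ K₂ C₀ C₁ M =
  MagicDistance δ K₁ K₂ C₀ C₁ M ×
  (CaseIII δ K₁ K₂ C₀ C₁ → K₁ + 2 * K₂ + 1 ≡ 2 * δ → M > K₁) ×
  (CaseIII δ K₁ K₂ C₀ C₁ → Cmax C₀ C₁ > Cmin C₀ C₁ + 1 →
     Cmin C₀ C₁ ≡ 2 * δ + K₂ → M < K₂)

-- Take M = K ⊔ ⌈δ/2⌉, where K = K₁ except in the tight Case (III)
-- K₁ + 2K₂ + 1 = 2δ, where K = K₁ + 1. The bound M ≤ K₂ comes from δ ≤ 2K₂, and
-- M ≤ ⌊(C − δ − 1)/2⌋ from 2K + δ + 1 ≤ C together with 2⌈δ/2⌉ ≤ δ + 1 ≤ C − δ − 1.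
-- In Case (III) any K with K₁ ≤ K ≤ K₂, 2δ ≤ K + 2K₂ and 2δ + K + 1 ≤ C works:
-- C = 2δ + K₂ forces K < K₂, hence 2δ < 3K₂, which for δ ≥ 3 gives ⌈δ/2⌉ < K₂.
-- In Case (II) the extra conditions are vacuous, as Cases (II) and (III) exclude each other.
module Submission where

open import Defs
open import Data.Nat using (ℕ; suc; _≟_; _+_; _*_; _∸_; _≤_; _<_; ⌊_/2⌋; ⌈_/2⌉; _⊔_; z≤n)
open import Data.Nat.Properties
open import Data.Nat.Tactic.RingSolver using (solve)
open import Data.Product using (∃; _,_)
open import Data.Sum using (inj₁; inj₂)
open import Data.List using ([]; _∷_)
open import Data.Empty using (⊥-elim)
open import Function using (_∘_)
open import Relation.Nullary using (¬_; yes; no)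
open import Relation.Binary.PropositionalEquality using (_≡_; refl; sym; trans; subst; cong)

2*n≡n+n : ∀ n → 2 * n ≡ n + n
2*n≡n+n n = cong (n +_) (+-identityʳ n)

n≤2*k⇒⌈n/2⌉≤k : ∀ {n k} → n ≤ 2 * k → ⌈ n /2⌉ ≤ k
n≤2*k⇒⌈n/2⌉≤k {n} {k} n≤2k =
  subst (⌈ n /2⌉ ≤_) (sym (n≡⌈n+n/2⌉ k))
        (⌈n/2⌉-mono (subst (n ≤_) (2*n≡n+n k) n≤2k))

2*k≤n⇒k≤⌊n/2⌋ : ∀ {n k} → 2 * k ≤ n → k ≤ ⌊ n /2⌋
2*k≤n⇒k≤⌊n/2⌋ {n} {k} 2k≤n =
  subst (_≤ ⌊ n /2⌋) (sym (n≡⌊n+n/2⌋ k))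
        (⌊n/2⌋-mono (subst (_≤ n) (2*n≡n+n k) 2k≤n))

2*⌈n/2⌉≤1+n : ∀ n → 2 * ⌈ n /2⌉ ≤ 1 + n
2*⌈n/2⌉≤1+n 0 = z≤n
2*⌈n/2⌉≤1+n 1 = ≤-refl
2*⌈n/2⌉≤1+n (suc (suc n)) = begin
  2 * suc ⌈ n /2⌉  ≡⟨ *-suc 2 ⌈ n /2⌉ ⟩
  2 + 2 * ⌈ n /2⌉  ≤⟨ +-monoʳ-≤ 2 (2*⌈n/2⌉≤1+n n) ⟩
  2 + (1 + n)      ∎
  where open ≤-Reasoning

2*m+n+1≤o⇒m≤⌊o∸n∸1/2⌋ : ∀ {m n o} → 2 * m + n + 1 ≤ o → m ≤ ⌊ (o ∸ n ∸ 1) /2⌋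
2*m+n+1≤o⇒m≤⌊o∸n∸1/2⌋ {m} {n} {o} le =
  2*k≤n⇒k≤⌊n/2⌋ (subst (2 * m ≤_) (sym (∸-+-assoc o n 1))
    (m+n≤o⇒m≤o∸n (2 * m) (subst (_≤ o) (+-assoc (2 * m) n 1) le)))

2*m≤3*n⇒m≤2*n : ∀ {m n} → 2 * m ≤ 3 * n → m ≤ 2 * n
2*m≤3*n⇒m≤2*n {m} {n} le = *-cancelˡ-≤ 2 (begin
  2 * m        ≤⟨ le ⟩
  3 * n        ≤⟨ *-monoˡ-≤ n (n≤1+n 3) ⟩
  4 * n        ≡⟨ solve (n ∷ []) ⟩
  2 * (2 * n)  ∎)
  where open ≤-Reasoning

-- If instead 2k ≤ n + 1, then 2(2n + 1) ≤ 3 · 2k ≤ 3(n + 1), i.e. n ≤ 1.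
2*n<3*k⇒2+n≤2*k : ∀ {n k} → 2 ≤ n → 2 * n < 3 * k → 2 + n ≤ 2 * k
2*n<3*k⇒2+n≤2*k {n} {k} 2≤n 2n<3k = ≮⇒≥ λ 2k<2+n →
  <-irrefl refl (≤-trans (+-monoˡ-≤ 2 2≤n) (+-cancelˡ-≤ (3 * n) (n + 2) 3 (begin
    3 * n + (n + 2)    ≡⟨ solve (n ∷ []) ⟩
    2 * suc (2 * n)    ≤⟨ *-monoʳ-≤ 2 2n<3k ⟩
    2 * (3 * k)        ≡⟨ solve (k ∷ []) ⟩
    3 * (2 * k)        ≤⟨ *-monoʳ-≤ 3 (m<1+n⇒m≤n 2k<2+n) ⟩
    3 * (1 + n)        ≡⟨ solve (n ∷ []) ⟩
    3 * n + 3          ∎)))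
  where open ≤-Reasoning

module _ {δ K₁ K₂ C₀ C₁ : ℕ} where

  private
    C = Cmin C₀ C₁
    h = ⌈ δ /2⌉

  magicDistance-⊔⌈δ/2⌉ : ∀ {K} → Acceptable δ K₁ K₂ C₀ C₁ →
    K₁ ≤ K → K ≤ K₂ → δ ≤ 2 * K₂ → 2 * K + δ + 1 ≤ C →
    MagicDistance δ K₁ K₂ C₀ C₁ (K ⊔ h)
  magicDistance-⊔⌈δ/2⌉ {K} (_ , 1≤K₁ , _ , K₂≤δ , 2δ+2≤C₀ , _ , 2δ+2≤C₁ , _)
                        K₁≤K K≤K₂ δ≤2K₂ 2K+δ+1≤C =
    ≤-trans (≤-trans 1≤K₁ K₁≤K) (m≤m⊔n K h) ,
    ≤-trans M≤K₂ K₂≤δ ,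
    ⊔-monoˡ-≤ h K₁≤K ,
    ⊓-glb M≤K₂ (⊔-lub (2*m+n+1≤o⇒m≤⌊o∸n∸1/2⌋ {K} 2K+δ+1≤C)
                       (2*m+n+1≤o⇒m≤⌊o∸n∸1/2⌋ {h} 2h+δ+1≤C))
    where
    open ≤-Reasoning
    M≤K₂ : K ⊔ h ≤ K₂
    M≤K₂ = ⊔-lub K≤K₂ (n≤2*k⇒⌈n/2⌉≤k {k = K₂} δ≤2K₂)
    2h+δ+1≤C : 2 * h + δ + 1 ≤ C
    2h+δ+1≤C = begin
      2 * h + δ + 1      ≤⟨ +-monoˡ-≤ 1 (+-monoˡ-≤ δ (2*⌈n/2⌉≤1+n δ)) ⟩
      1 + δ + δ + 1      ≡⟨ solve (δ ∷ []) ⟩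
      2 * δ + 2          ≤⟨ ⊓-glb 2δ+2≤C₀ 2δ+2≤C₁ ⟩
      C                  ∎

  CaseII⇒¬CaseIII : CaseII δ K₁ K₂ C₀ C₁ → ¬ CaseIII δ K₁ K₂ C₀ C₁
  CaseII⇒¬CaseIII (C≤2δ+K₁ , _) (2δ+K₁+1≤C , _) =
    ≤⇒≯ C≤2δ+K₁ (subst (_≤ C) (+-comm (2 * δ + K₁) 1) 2δ+K₁+1≤C)

  magicParameter-CaseII : Acceptable δ K₁ K₂ C₀ C₁ → CaseII δ K₁ K₂ C₀ C₁ →
    MagicParameter δ K₁ K₂ C₀ C₁ (K₁ ⊔ h)
  magicParameter-CaseII acc@(_ , _ , K₁≤K₂ , _) ii@(_ , C≡ , δ≤K₁+K₂ , _) =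
    magicDistance-⊔⌈δ/2⌉ acc ≤-refl K₁≤K₂ δ≤2K₂ 2K₁+δ+1≤C ,
    (λ iii _ → ⊥-elim (CaseII⇒¬CaseIII ii iii)) ,
    (λ iii _ _ → ⊥-elim (CaseII⇒¬CaseIII ii iii))
    where
    open ≤-Reasoning
    δ≤2K₂ : δ ≤ 2 * K₂
    δ≤2K₂ = begin
      δ         ≤⟨ δ≤K₁+K₂ ⟩
      K₁ + K₂   ≤⟨ +-monoˡ-≤ K₂ K₁≤K₂ ⟩
      K₂ + K₂   ≡⟨ sym (2*n≡n+n K₂) ⟩
      2 * K₂    ∎
    2K₁+δ+1≤C : 2 * K₁ + δ + 1 ≤ C
    2K₁+δ+1≤C = begin
      2 * K₁ + δ + 1         ≤⟨ +-monoˡ-≤ 1 (+-monoʳ-≤ (2 * K₁) δ≤2K₂) ⟩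
      2 * K₁ + 2 * K₂ + 1    ≡⟨ sym C≡ ⟩
      C                      ∎

  magicParameter-⊔⌈δ/2⌉ : ∀ {K} → Acceptable δ K₁ K₂ C₀ C₁ →
    K₁ ≤ K → K ≤ K₂ → 2 * δ ≤ K + 2 * K₂ → 2 * δ + K + 1 ≤ C →
    MagicParameter δ K₁ K₂ C₀ C₁ (K ⊔ h)
  magicParameter-⊔⌈δ/2⌉ {K} acc@(3≤δ , _ , _ , K₂≤δ , _) K₁≤K K≤K₂ 2δ≤K+2K₂ 2δ+K+1≤C =
    magicDistance-⊔⌈δ/2⌉ acc K₁≤K K≤K₂ (2*m≤3*n⇒m≤2*n {n = K₂} 2δ≤3K₂) 2K+δ+1≤C ,
    (λ _ tight → <-≤-trans (K₁<K tight) (m≤m⊔n K h)) ,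
    (λ _ _ C≡ → ⊔-pres-<m (K<K₂ C≡) (h<K₂ (K<K₂ C≡)))
    where
    open ≤-Reasoning
    2δ≤3K₂ : 2 * δ ≤ 3 * K₂
    2δ≤3K₂ = begin
      2 * δ         ≤⟨ 2δ≤K+2K₂ ⟩
      K + 2 * K₂    ≤⟨ +-monoˡ-≤ (2 * K₂) K≤K₂ ⟩
      K₂ + 2 * K₂   ≡⟨ solve (K₂ ∷ []) ⟩
      3 * K₂        ∎
    2K+δ+1≤C : 2 * K + δ + 1 ≤ C
    2K+δ+1≤C = begin
      2 * K + δ + 1          ≡⟨ solve (K ∷ δ ∷ []) ⟩
      K + δ + (K + 1)        ≤⟨ +-monoˡ-≤ (K + 1) (+-monoˡ-≤ δ (≤-trans K≤K₂ K₂≤δ)) ⟩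
      δ + δ + (K + 1)        ≡⟨ solve (K ∷ δ ∷ []) ⟩
      2 * δ + K + 1          ≤⟨ 2δ+K+1≤C ⟩
      C                      ∎
    K₁<K : K₁ + 2 * K₂ + 1 ≡ 2 * δ → K₁ < K
    K₁<K tight = +-cancelʳ-≤ (2 * K₂) (suc K₁) K (begin
      suc K₁ + 2 * K₂        ≡⟨ solve (K₁ ∷ K₂ ∷ []) ⟩
      K₁ + 2 * K₂ + 1        ≡⟨ tight ⟩
      2 * δ                  ≤⟨ 2δ≤K+2K₂ ⟩
      K + 2 * K₂             ∎)
    K<K₂ : C ≡ 2 * δ + K₂ → K < K₂
    K<K₂ C≡ = +-cancelˡ-≤ (2 * δ) (suc K) K₂ (begin
      2 * δ + suc K          ≡⟨ solve (δ ∷ K ∷ []) ⟩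
      2 * δ + K + 1          ≤⟨ 2δ+K+1≤C ⟩
      C                      ≡⟨ C≡ ⟩
      2 * δ + K₂             ∎)
    h<K₂ : K < K₂ → h < K₂
    h<K₂ K<K₂ = n≤2*k⇒⌈n/2⌉≤k {k = K₂}
      (2*n<3*k⇒2+n≤2*k {k = K₂} (≤-trans (n≤1+n 2) 3≤δ) (begin-strict
      2 * δ                  ≤⟨ 2δ≤K+2K₂ ⟩
      K + 2 * K₂             <⟨ +-monoˡ-< (2 * K₂) K<K₂ ⟩
      K₂ + 2 * K₂            ≡⟨ solve (K₂ ∷ []) ⟩
      3 * K₂                 ∎))

  ∃magicParameter-CaseIII : Acceptable δ K₁ K₂ C₀ C₁ → CaseIII δ K₁ K₂ C₀ C₁ →
    ∃ λ M → MagicParameter δ K₁ K₂ C₀ C₁ M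
  ∃magicParameter-CaseIII acc@(_ , _ , K₁≤K₂ , _)
    (2δ+K₁+1≤C , 2δ≤K₁+2K₂+1 , 2δ≤3K₂ , tight⇒2δ+K₁+2≤C , _)
    with K₁ + 2 * K₂ + 1 ≟ 2 * δ
  ... | yes tight =
    suc K₁ ⊔ h ,
    magicParameter-⊔⌈δ/2⌉ acc (n≤1+n K₁) 1+K₁≤K₂ (≤-reflexive (sym 1+K₁+2K₂≡2δ)) 2δ+1+K₁+1≤C
    where
    open ≤-Reasoning
    1+K₁+2K₂≡2δ : suc K₁ + 2 * K₂ ≡ 2 * δ
    1+K₁+2K₂≡2δ = trans (+-comm 1 (K₁ + 2 * K₂)) tight
    1+K₁≤K₂ : suc K₁ ≤ K₂
    1+K₁≤K₂ = +-cancelʳ-≤ (2 * K₂) (suc K₁) K₂ (begin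
      suc K₁ + 2 * K₂    ≡⟨ 1+K₁+2K₂≡2δ ⟩
      2 * δ              ≤⟨ 2δ≤3K₂ ⟩
      3 * K₂             ≡⟨ solve (K₂ ∷ []) ⟩
      K₂ + 2 * K₂        ∎)
    2δ+1+K₁+1≤C : 2 * δ + suc K₁ + 1 ≤ C
    2δ+1+K₁+1≤C = begin
      2 * δ + suc K₁ + 1  ≡⟨ solve (δ ∷ K₁ ∷ []) ⟩
      2 * δ + K₁ + 2      ≤⟨ tight⇒2δ+K₁+2≤C tight ⟩
      C                   ∎
  ... | no loose =
    K₁ ⊔ h ,
    magicParameter-⊔⌈δ/2⌉ acc ≤-refl K₁≤K₂ 2δ≤K₁+2K₂ 2δ+K₁+1≤C
    where
    2δ≤K₁+2K₂ : 2 * δ ≤ K₁ + 2 * K₂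
    2δ≤K₁+2K₂ = m<1+n⇒m≤n (subst (2 * δ <_) (+-comm (K₁ + 2 * K₂) 1)
                                  (≤∧≢⇒< 2δ≤K₁+2K₂+1 (loose ∘ sym)))

lemma5p6 : (δ K₁ K₂ C₀ C₁ : ℕ) → Admissible δ K₁ K₂ C₀ C₁ →
    ∃ λ M → MagicParameter δ K₁ K₂ C₀ C₁ M
lemma5p6 δ K₁ K₂ C₀ C₁ (acc , inj₁ ii)  = K₁ ⊔ ⌈ δ /2⌉ , magicParameter-CaseII acc ii
lemma5p6 δ K₁ K₂ C₀ C₁ (acc , inj₂ iii) = ∃magicParameter-CaseIII acc iii
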